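{- Let $n_0\ge 0$ be an integer and let $\mathbf{x}$ be a sequence over a finite alphabet with no palindromic factor of length $\geq n_0$. Then $r_{\mathbf{x}}(n) \leq r_{\mathbf{x}}(n+1)$ for all $n \geq n_0$. Furthermore, if $r_{\mathbf{x}}(n+2) = r_{\mathbf{x}}(n)$ for some $n \geq n_0$, then $\mathbf{x}$ is eventually periodic.
   Context: A factor of a sequence is a finite contiguous block. For $u=u(1)\cdots u(m)$, $u^R=u(m)\cdots u(1)$; a palindrome satisfies $u=u^R$. $r_{\mathbf{x}}(n)$ is the number of distinct length-$n$ factors of $\mathbf{x}$ up to $u\sim v\iff v\in\{u,u^R\}$. $\mathbf{x}$ is eventually periodic if $\mathbf{x}=uv^\omega$ with $v$ nonempty. -}

module Defs where

open import Data.Nat using (ℕ; _+_; _≤_; _<_; _≥_)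
open import Data.Fin using (Fin; toℕ)
open import Data.Vec using (Vec; tabulate; reverse; lookup)
open import Data.Product using (Σ; ∃; _×_; _,_)
open import Data.Sum using (_⊎_)
open import Relation.Binary.PropositionalEquality using (_≡_; _≢_)
open import Relation.Nullary using (¬_)

Seq : ℕ → Set
Seq k = ℕ → Fin k

Word : ℕ → ℕ → Set
Word k n = Vec (Fin k) n

factorAt : ∀ {k} → Seq k → ℕ → (n : ℕ) → Word k n
factorAt x i n = tabulate (λ j → x (i + toℕ j))

IsFactor : ∀ {k n} → Seq k → Word k n → Set
IsFactor x w = ∃ λ i → factorAt x i _ ≡ w

IsPalindrome : ∀ {k n} → Word k n → Set
IsPalindrome w = reverse w ≡ w

_∼_ : ∀ {k n} → Word k n → Word k n → Set
u ∼ v = (v ≡ u) ⊎ (v ≡ reverse u)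

-- r_x(n) = m : there is a list of m length-n factors of x, pairwise
-- inequivalent under ∼, such that every length-n factor of x is
-- equivalent to one of them (i.e. m is the number of ∼-classes of
-- length-n factors).
RComplexity : ∀ {k} → Seq k → ℕ → ℕ → Set
RComplexity {k} x n m =
  Σ (Vec (Word k n) m) λ L →
      ((a : Fin m) → IsFactor x (lookup L a))
    × ((a b : Fin m) → a ≢ b → ¬ (lookup L a ∼ lookup L b))
    × ((w : Word k n) → IsFactor x w → ∃ λ a → w ∼ lookup L a)

NoPalindromesFrom : ∀ {k} → Seq k → ℕ → Set
NoPalindromesFrom x n₀ = ∀ m → m ≥ n₀ → ∀ i → ¬ IsPalindrome (factorAt x i m)

EventuallyPeriodic : ∀ {k} → Seq k → Set
EventuallyPeriodic x = ∃ λ p → 0 < p × ∃ λ N → ∀ i → i ≥ N → x (i + p) ≡ x i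

{-# OPTIONS --safe #-}
-- Let F̄ₘ be the set of length-m factors of x together with their reversals. Without palindromes
-- of length m every ∼-class has exactly two elements in F̄ₘ, so |F̄ₘ| = 2 r(m). Every word of F̄ₘ
-- except possibly the reversed prefix has a right extension in F̄ₘ₊₁ (a reversed factor occurring
-- at t > 0 is extended by the letter x(t-1)), and distinct words have distinct extensions; hence
-- 2 r(m) ≤ 2 r(m+1) + 1, i.e. r(m) ≤ r(m+1). If r(n) = r(n+2), monotonicity forces r(n) = r(n+1).
-- When the reversed prefix also extends, taking prefixes is then a bijection F̄ₙ₊₁ → F̄ₙ, so every
-- length-n factor determines the next letter, and any repeated length-n factor makes x
-- eventually periodic. Otherwise the ∼-class of the prefix occurs only at position 0, and deleting
-- the first letter of x lowers both r(n) and r(n+1) by one: induction on r(n).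

module Submission where

open import Defs
open import Data.Nat using (ℕ; zero; suc; _+_; _∸_; _≤_; _<_; _≥_; s≤s)
open import Data.Nat.Properties
open import Data.Fin as Fin using (Fin; zero; suc; toℕ; inject₁; splitAt; join; _↑ˡ_; _↑ʳ_; punchIn; punchOut)
open import Data.Fin.Properties
  using (toℕ-inject₁; injective⇒≤; pigeonhole; any?; splitAt-join; join-splitAt; splitAt-↑ˡ; splitAt-↑ʳ;
         punchIn-injective; punchInᵢ≢i; punchIn-punchOut)
open import Data.Vec using (Vec; []; _∷_; lookup; tabulate; reverse; init; tail; head)
open import Data.Vec.Properties
  using (reverse-involutive; reverse-injective; reverse-reverse; init-reverse; tabulate-cong; lookup∘tabulate; ≡-dec)
open import Data.Product using (∃; ∃₂; _×_; _,_; proj₁; proj₂; map)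
open import Data.Sum using (_⊎_; inj₁; inj₂; [_,_])
open import Data.Empty using (⊥-elim)
open import Function using (_∘_; id)
open import Function.Definitions using (Injective)
open import Level using (_⊔_)
open import Relation.Binary.Core using (Rel)
open import Relation.Binary.Definitions using (Decidable; DecidableEquality; Reflexive; Symmetric)
open import Relation.Nullary using (¬_; yes; no; contradiction)
open import Relation.Nullary.Decidable using (_⊎-dec_)
open import Relation.Binary.PropositionalEquality hiding ([_])

module _ {a} {A : Set a} where

  cover⇒≤ : ∀ {m n} {E : Fin m → A} {F : Fin n → A} →
            Injective _≡_ _≡_ E → (∀ i → ∃ λ j → F j ≡ E i) → m ≤ n
  cover⇒≤ {E = E} {F} E-injective cover = injective⇒≤ preimage-injective
    where
    preimage-injective : Injective _≡_ _≡_ (proj₁ ∘ cover)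
    preimage-injective {i} {i′} eq = E-injective (begin
      E i                   ≡⟨ sym (proj₂ (cover i)) ⟩
      F (proj₁ (cover i))   ≡⟨ cong F eq ⟩
      F (proj₁ (cover i′))  ≡⟨ proj₂ (cover i′) ⟩
      E i′                  ∎)
      where open ≡-Reasoning

  cover⇒injective : ∀ {n} {E F : Fin n → A} →
                    Injective _≡_ _≡_ E → (∀ i → ∃ λ j → F j ≡ E i) → Injective _≡_ _≡_ F
  cover⇒injective {zero} _ _ {()}
  cover⇒injective {suc n} {E} {F} E-injective cover {j} {j′} Fj≡Fj′ with j Fin.≟ j′
  ... | yes j≡j′ = j≡j′
  ... | no j≢j′ = contradiction (cover⇒≤ E-injective cover-without-j) 1+n≰n
    where
    -- F j is also attained at j′, so F still covers E once j is removed from its domain.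
    cover-without-j : ∀ i → ∃ λ l → F (punchIn j l) ≡ E i
    cover-without-j i with cover i
    ... | l , Fl≡Ei with j Fin.≟ l
    ...   | yes refl = punchOut j≢j′ , trans (cong F (punchIn-punchOut j≢j′)) (trans (sym Fj≡Fj′) Fl≡Ei)
    ...   | no j≢l   = punchOut j≢l , trans (cong F (punchIn-punchOut j≢l)) Fl≡Ei

double-≤-suc⇒≤ : ∀ c d → c + c ≤ suc (d + d) → c ≤ d
double-≤-suc⇒≤ c d c+c≤1+d+d = ≮⇒≥ λ d<c → 1+n≰n (begin
  suc (suc (d + d))  ≡⟨ cong suc (+-suc d d) ⟨
  suc d + suc d      ≤⟨ +-mono-≤ d<c d<c ⟩
  c + c              ≤⟨ c+c≤1+d+d ⟩
  suc (d + d)        ∎)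
  where open ≤-Reasoning

module _ {a ℓ} {A : Set a} (R : Rel A ℓ) where

  record Representatives {n} (xs : Fin n → A) : Set (a ⊔ ℓ) where
    field
      size     : ℕ
      reps     : Vec A size
      reps⊆xs  : ∀ j → ∃ λ i → lookup reps j ≡ xs i
      distinct : ∀ j j′ → j ≢ j′ → ¬ R (lookup reps j) (lookup reps j′)
      covering : ∀ i → ∃ λ j → R (xs i) (lookup reps j)

  module _ (R? : Decidable R) (R-refl : Reflexive R) (R-sym : Symmetric R) where

    representatives : ∀ {n} (xs : Fin n → A) → Representatives xs
    representatives {zero} xs = record
      { size = 0 ; reps = [] ; reps⊆xs = λ () ; distinct = λ () ; covering = λ () }
    representatives {suc n} xs = addHead (representatives (xs ∘ suc))
      where
      addHead : Representatives (xs ∘ suc) → Representatives xs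
      addHead r with any? (λ j → R? (xs zero) (lookup (Representatives.reps r) j))
      ... | yes (j , x₀Rj) = record
        { size = size ; reps = reps
        ; reps⊆xs = map suc id ∘ reps⊆xs
        ; distinct = distinct
        ; covering = λ { zero → j , x₀Rj ; (suc i) → covering i }
        }
        where open Representatives r
      ... | no ¬x₀R = record
        { size = suc size ; reps = xs zero ∷ reps
        ; reps⊆xs = λ { zero → zero , refl ; (suc j) → map suc id (reps⊆xs j) }
        ; distinct = distinct′
        ; covering = λ { zero → zero , R-refl ; (suc i) → map suc id (covering i) }
        }
        where
        open Representatives r
        distinct′ : ∀ j j′ → j ≢ j′ → ¬ R (lookup (xs zero ∷ reps) j) (lookup (xs zero ∷ reps) j′)
        distinct′ zero    zero     j≢j′ = contradiction refl j≢j′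
        distinct′ zero    (suc j′) _    = ¬x₀R ∘ (j′ ,_)
        distinct′ (suc j) zero     _    = ¬x₀R ∘ (j ,_) ∘ R-sym
        distinct′ (suc j) (suc j′) j≢j′ = distinct j j′ (j≢j′ ∘ cong suc)

init-tabulate : ∀ {a} {A : Set a} {n} (f : Fin (suc n) → A) → init (tabulate f) ≡ tabulate (f ∘ inject₁)
init-tabulate {n = zero}  f = refl
init-tabulate {n = suc n} f = cong (f zero ∷_) (init-tabulate (f ∘ suc))

tail-reverse : ∀ {a} {A : Set a} {n} (u : Vec A (suc n)) → tail (reverse u) ≡ reverse (init u)
tail-reverse u = sym (reverse-reverse (begin
  reverse (tail (reverse u))  ≡⟨ init-reverse (reverse u) ⟨
  init (reverse (reverse u))  ≡⟨ cong init (reverse-involutive u) ⟩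
  init u                      ∎))
  where open ≡-Reasoning

module _ {k : ℕ} where

  _≟ʷ_ : ∀ {m} → DecidableEquality (Word k m)
  _≟ʷ_ = ≡-dec Fin._≟_

  ∼-refl : ∀ {m} {u : Word k m} → u ∼ u
  ∼-refl = inj₁ refl

  ∼-sym : ∀ {m} {u v : Word k m} → u ∼ v → v ∼ u
  ∼-sym         (inj₁ refl) = inj₁ refl
  ∼-sym {u = u} (inj₂ refl) = inj₂ (sym (reverse-involutive u))

  ∼-trans : ∀ {m} {u v w : Word k m} → u ∼ v → v ∼ w → u ∼ w
  ∼-trans         (inj₁ refl) v∼w         = v∼w
  ∼-trans         (inj₂ refl) (inj₁ refl) = inj₂ refl
  ∼-trans {u = u} (inj₂ refl) (inj₂ refl) = inj₁ (reverse-involutive u)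

  ∼-dec : ∀ {m} → Decidable (_∼_ {k} {m})
  ∼-dec u v = (v ≟ʷ u) ⊎-dec (v ≟ʷ reverse u)

  NoPalindromesOfLength : Seq k → ℕ → Set
  NoPalindromesOfLength y m = ∀ t → ¬ IsPalindrome (factorAt y t m)

  OccursUpToReversal : ∀ {m} → Seq k → Word k m → Set
  OccursUpToReversal y w = IsFactor y w ⊎ IsFactor y (reverse w)

  HasRightExtension : ∀ {m} → Seq k → Word k m → Set
  HasRightExtension {m} y u = ∃ λ (v : Word k (suc m)) → OccursUpToReversal y v × init v ≡ u

  module _ (y : Seq k) where

    factorAt-init : ∀ t m → init (factorAt y t (suc m)) ≡ factorAt y t m
    factorAt-init t m = trans (init-tabulate (λ j → y (t + toℕ j)))
                              (tabulate-cong λ j → cong (λ i → y (t + i)) (toℕ-inject₁ j))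

    factorAt-tail : ∀ t m → tail (factorAt y t (suc m)) ≡ factorAt y (suc t) m
    factorAt-tail t m = tabulate-cong λ j → cong y (+-suc t (toℕ j))

    factorAt-head : ∀ t m → head (factorAt y t (suc m)) ≡ y t
    factorAt-head t m = cong y (+-identityʳ t)

    factor-hasRightExtension : ∀ t m → HasRightExtension y (factorAt y t m)
    factor-hasRightExtension t m = factorAt y t (suc m) , inj₁ (t , refl) , factorAt-init t m

    reversedFactor-hasRightExtension : ∀ t m → HasRightExtension y (reverse (factorAt y (suc t) m))
    reversedFactor-hasRightExtension t m =
      reverse w , inj₂ (t , sym (reverse-involutive w)) , trans (init-reverse w) (cong reverse (factorAt-tail t m))
      where
      w : Word k (suc m)
      w = factorAt y t (suc m)

    -- Only the reversed prefix can fail to extend: its reversal has nothing to its left.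
    hasRightExtension : ∀ {m} {u : Word k m} → OccursUpToReversal y u →
                        u ≢ reverse (factorAt y 0 m) → HasRightExtension y u
    hasRightExtension {m} (inj₁ (t , refl))    _ = factor-hasRightExtension t m
    hasRightExtension     (inj₂ (zero , eq))   u≢p̃ = contradiction (sym (reverse-reverse (sym eq))) u≢p̃
    hasRightExtension {m} (inj₂ (suc t , eq))  _ =
      subst (HasRightExtension y) (reverse-reverse (sym eq)) (reversedFactor-hasRightExtension t m)

module _ {k m c} (y : Seq k) (R : RComplexity y m c) where

  private
    L : Vec (Word k m) c
    L = proj₁ R

    rep-factor : ∀ a → IsFactor y (lookup L a)
    rep-factor = proj₁ (proj₂ R)

    rep-distinct : ∀ a b → a ≢ b → ¬ (lookup L a ∼ lookup L b)
    rep-distinct = proj₁ (proj₂ (proj₂ R))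

    rep-cover : ∀ w → IsFactor y w → ∃ λ a → w ∼ lookup L a
    rep-cover = proj₂ (proj₂ (proj₂ R))

    orientedRep : Fin c ⊎ Fin c → Word k m
    orientedRep = [ lookup L , reverse ∘ lookup L ]

  -- F̄ₘ, listed as every representative in both orientations.
  oriented : Fin (c + c) → Word k m
  oriented = orientedRep ∘ splitAt c

  oriented-occurs : ∀ i → OccursUpToReversal y (oriented i)
  oriented-occurs i with splitAt c i
  ... | inj₁ a = inj₁ (rep-factor a)
  ... | inj₂ a = inj₂ (subst (IsFactor y) (sym (reverse-involutive (lookup L a))) (rep-factor a))

  private
    orientedRep-complete : ∀ {w} → OccursUpToReversal y w → ∃ λ s → orientedRep s ≡ w
    orientedRep-complete {w} (inj₁ w-factor) with rep-cover w w-factor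
    ... | a , inj₁ eq = inj₁ a , eq
    ... | a , inj₂ eq = inj₂ a , reverse-reverse (sym eq)
    orientedRep-complete {w} (inj₂ w̃-factor) with rep-cover (reverse w) w̃-factor
    ... | a , inj₁ eq = inj₂ a , reverse-reverse (sym eq)
    ... | a , inj₂ eq = inj₁ a , trans eq (reverse-involutive w)

  oriented-complete : ∀ {w} → OccursUpToReversal y w → ∃ λ i → oriented i ≡ w
  oriented-complete occ with s , eq ← orientedRep-complete occ =
    join c c s , trans (cong orientedRep (splitAt-join c c s)) eq

  oriented-injective : NoPalindromesOfLength y m → Injective _≡_ _≡_ oriented
  oriented-injective noPal {i} {i′} eq = begin
    i                       ≡⟨ join-splitAt c c i ⟨
    join c c (splitAt c i)  ≡⟨ cong (join c c) (orientedRep-injective {splitAt c i} {splitAt c i′} eq) ⟩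
    join c c (splitAt c i′) ≡⟨ join-splitAt c c i′ ⟩
    i′                      ∎
    where
    open ≡-Reasoning

    rep-∼⇒≡ : ∀ {a b} → lookup L a ∼ lookup L b → a ≡ b
    rep-∼⇒≡ {a} {b} a∼b with a Fin.≟ b
    ... | yes a≡b = a≡b
    ... | no a≢b  = contradiction a∼b (rep-distinct a b a≢b)

    rep-nonPalindrome : ∀ a → ¬ IsPalindrome (lookup L a)
    rep-nonPalindrome a with t , eq ← rep-factor a = noPal t ∘ subst IsPalindrome (sym eq)

    orientedRep-injective : Injective _≡_ _≡_ orientedRep
    orientedRep-injective {inj₁ a} {inj₁ b} eq = cong inj₁ (rep-∼⇒≡ (inj₁ (sym eq)))
    orientedRep-injective {inj₁ a} {inj₂ b} eq with refl ← rep-∼⇒≡ (inj₂ eq) =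
      ⊥-elim (rep-nonPalindrome a (sym eq))
    orientedRep-injective {inj₂ a} {inj₁ b} eq with refl ← rep-∼⇒≡ (inj₂ (sym eq)) =
      ⊥-elim (rep-nonPalindrome a eq)
    orientedRep-injective {inj₂ a} {inj₂ b} eq = cong inj₂ (rep-∼⇒≡ (inj₁ (sym (reverse-injective eq))))

rightExtension-index : ∀ {k m d} (y : Seq k) (R : RComplexity y (suc m) d) {u : Word k m} →
                       HasRightExtension y u → ∃ λ j → init (oriented y R j) ≡ u
rightExtension-index y R (v , v-occurs , init-v≡u) with j , eq ← oriented-complete y R v-occurs =
  j , trans (cong init eq) init-v≡u

rcomplexity-monotone : ∀ {k m c d} (y : Seq k) → NoPalindromesOfLength y m →
                       RComplexity y m c → RComplexity y (suc m) d → c ≤ d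
rcomplexity-monotone {k} {m} {c} {d} y noPal R R′ =
  double-≤-suc⇒≤ c d (cover⇒≤ {F = extensionOrReversedPrefix} (oriented-injective y R noPal) covered)
  where
  p̃ : Word k m
  p̃ = reverse (factorAt y 0 m)

  extensionOrReversedPrefix : Fin (suc (d + d)) → Word k m
  extensionOrReversedPrefix zero    = p̃
  extensionOrReversedPrefix (suc j) = init (oriented y R′ j)

  covered : ∀ i → ∃ λ j → extensionOrReversedPrefix j ≡ oriented y R i
  covered i with oriented y R i ≟ʷ p̃
  ... | yes eq = zero , sym eq
  ... | no neq = map suc id (rightExtension-index y R′ (hasRightExtension y (oriented-occurs y R i) neq))

rcomplexity-shorter : ∀ {k m c} (y : Seq k) → RComplexity y (suc m) c → ∃ λ b → RComplexity y m b
rcomplexity-shorter {k} {m} {c} y (L , factor , _ , cover) = size , reps , reps-factor , distinct , reps-cover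
  where
  prefixOrSuffix⊎ : Fin c ⊎ Fin c → Word k m
  prefixOrSuffix⊎ = [ init ∘ lookup L , tail ∘ lookup L ]

  prefixOrSuffix : Fin (c + c) → Word k m
  prefixOrSuffix = prefixOrSuffix⊎ ∘ splitAt c

  prefixOrSuffix-factor : ∀ i → IsFactor y (prefixOrSuffix i)
  prefixOrSuffix-factor i with splitAt c i
  ... | inj₁ a with t , eq ← factor a = t , trans (sym (factorAt-init y t m)) (cong init eq)
  ... | inj₂ a with t , eq ← factor a = suc t , trans (sym (factorAt-tail y t m)) (cong tail eq)

  open Representatives (representatives _∼_ ∼-dec ∼-refl ∼-sym prefixOrSuffix)

  reps-factor : ∀ j → IsFactor y (lookup reps j)
  reps-factor j with i , eq ← reps⊆xs j = subst (IsFactor y) (sym eq) (prefixOrSuffix-factor i)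

  factor∼prefixOrSuffix : ∀ t → ∃ λ i → factorAt y t m ∼ prefixOrSuffix i
  factor∼prefixOrSuffix t with cover (factorAt y t (suc m)) (t , refl)
  ... | a , inj₁ eq = a ↑ˡ c , inj₁ (begin
    prefixOrSuffix (a ↑ˡ c)       ≡⟨ cong prefixOrSuffix⊎ (splitAt-↑ˡ c a c) ⟩
    init (lookup L a)             ≡⟨ cong init eq ⟩
    init (factorAt y t (suc m))   ≡⟨ factorAt-init y t m ⟩
    factorAt y t m                ∎)
    where open ≡-Reasoning
  ... | a , inj₂ eq = c ↑ʳ a , inj₂ (begin
    prefixOrSuffix (c ↑ʳ a)                ≡⟨ cong prefixOrSuffix⊎ (splitAt-↑ʳ c c a) ⟩
    tail (lookup L a)                      ≡⟨ cong tail eq ⟩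
    tail (reverse (factorAt y t (suc m)))  ≡⟨ tail-reverse _ ⟩
    reverse (init (factorAt y t (suc m)))  ≡⟨ cong reverse (factorAt-init y t m) ⟩
    reverse (factorAt y t m)               ∎)
    where open ≡-Reasoning

  reps-cover : ∀ w → IsFactor y w → ∃ λ j → w ∼ lookup reps j
  reps-cover _ (t , refl) with i , w∼i ← factor∼prefixOrSuffix t = map id (∼-trans w∼i) (covering i)

module _ {k : ℕ} (y : Seq k) (m : ℕ) where

  RightDeterministic : Set
  RightDeterministic = ∀ a b → factorAt y a m ≡ factorAt y b m → factorAt y a (suc m) ≡ factorAt y b (suc m)

  HasRepeatedFactor : Set
  HasRepeatedFactor = ∃₂ λ i j → i < j × factorAt y i m ≡ factorAt y j m

  finitelyManyFactors⇒hasRepeatedFactor : ∀ {n} {E : Fin n → Word k m} →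
                                          (∀ t → ∃ λ i → E i ≡ factorAt y t m) → HasRepeatedFactor
  finitelyManyFactors⇒hasRepeatedFactor {n} {E} index
    with i , j , i<j , same ← pigeonhole (n<1+n n) (proj₁ ∘ index ∘ toℕ) =
    toℕ i , toℕ j , i<j , trans (sym (proj₂ (index (toℕ i)))) (trans (cong E same) (proj₂ (index (toℕ j))))

  rightDeterministic⇒eventuallyPeriodic : RightDeterministic → HasRepeatedFactor → EventuallyPeriodic y
  rightDeterministic⇒eventuallyPeriodic det (i , j , i<j , same) = j ∸ i , m<n⇒0<n∸m i<j , i , periodic
    where
    windows : ∀ t → factorAt y (t + i) m ≡ factorAt y (t + j) m
    windows zero    = same
    windows (suc t) = begin
      factorAt y (suc t + i) m            ≡⟨ factorAt-tail y (t + i) m ⟨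
      tail (factorAt y (t + i) (suc m))   ≡⟨ cong tail (det _ _ (windows t)) ⟩
      tail (factorAt y (t + j) (suc m))   ≡⟨ factorAt-tail y (t + j) m ⟩
      factorAt y (suc t + j) m            ∎
      where open ≡-Reasoning

    letters : ∀ t → y (t + i) ≡ y (t + j)
    letters t = begin
      y (t + i)                           ≡⟨ factorAt-head y (t + i) m ⟨
      head (factorAt y (t + i) (suc m))   ≡⟨ cong head (det _ _ (windows t)) ⟩
      head (factorAt y (t + j) (suc m))   ≡⟨ factorAt-head y (t + j) m ⟩
      y (t + j)                           ∎
      where open ≡-Reasoning

    periodic : ∀ s → s ≥ i → y (s + (j ∸ i)) ≡ y s
    periodic s s≥i = begin
      y (s + (j ∸ i))            ≡⟨ cong (λ s → y (s + (j ∸ i))) (m∸n+n≡m s≥i) ⟨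
      y ((s ∸ i + i) + (j ∸ i))  ≡⟨ cong y (+-assoc (s ∸ i) i (j ∸ i)) ⟩
      y (s ∸ i + (i + (j ∸ i)))  ≡⟨ cong (λ j → y (s ∸ i + j)) (m+[n∸m]≡n (<⇒≤ i<j)) ⟩
      y (s ∸ i + j)              ≡⟨ letters (s ∸ i) ⟨
      y (s ∸ i + i)              ≡⟨ cong y (m∸n+n≡m s≥i) ⟩
      y s                        ∎
      where open ≡-Reasoning

reversedPrefixExtends⇒init-injective : ∀ {k m c} (y : Seq k) → NoPalindromesOfLength y m →
  (R : RComplexity y m c) (R′ : RComplexity y (suc m) c) →
  (∃ λ j → init (oriented y R′ j) ≡ reverse (factorAt y 0 m)) →
  Injective _≡_ _≡_ (init ∘ oriented y R′)
reversedPrefixExtends⇒init-injective {m = m} y noPal R R′ (j₀ , extends-p̃) =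
  cover⇒injective (oriented-injective y R noPal) covered
  where
  covered : ∀ i → ∃ λ j → init (oriented y R′ j) ≡ oriented y R i
  covered i with oriented y R i ≟ʷ reverse (factorAt y 0 m)
  ... | yes eq = j₀ , trans extends-p̃ (sym eq)
  ... | no neq = rightExtension-index y R′ (hasRightExtension y (oriented-occurs y R i) neq)

init-injective⇒rightDeterministic : ∀ {k m d} (y : Seq k) (R′ : RComplexity y (suc m) d) →
  Injective _≡_ _≡_ (init ∘ oriented y R′) → RightDeterministic y m
init-injective⇒rightDeterministic {m = m} {d} y R′ init-injective a b same = begin
  factorAt y a (suc m)  ≡⟨ proj₂ (index a) ⟨
  oriented y R′ ja      ≡⟨ cong (oriented y R′) (init-injective same-prefix) ⟩
  oriented y R′ jb      ≡⟨ proj₂ (index b) ⟩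
  factorAt y b (suc m)  ∎
  where
  open ≡-Reasoning

  index : ∀ t → ∃ λ j → oriented y R′ j ≡ factorAt y t (suc m)
  index t = oriented-complete y R′ (inj₁ (t , refl))

  ja jb : Fin (d + d)
  ja = proj₁ (index a)
  jb = proj₁ (index b)

  same-prefix : init (oriented y R′ ja) ≡ init (oriented y R′ jb)
  same-prefix = begin
    init (oriented y R′ ja)      ≡⟨ cong init (proj₂ (index a)) ⟩
    init (factorAt y a (suc m))  ≡⟨ factorAt-init y a m ⟩
    factorAt y a m               ≡⟨ same ⟩
    factorAt y b m               ≡⟨ factorAt-init y b m ⟨
    init (factorAt y b (suc m))  ≡⟨ cong init (proj₂ (index b)) ⟨
    init (oriented y R′ jb)      ∎

shift : ∀ {k} → Seq k → Seq k
shift y t = y (suc t)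

eventuallyPeriodic-shift⁻ : ∀ {k} {y : Seq k} → EventuallyPeriodic (shift y) → EventuallyPeriodic y
eventuallyPeriodic-shift⁻ (p , 0<p , N , periodic) =
  p , 0<p , suc N , λ { zero () ; (suc i) (s≤s N≤i) → periodic i N≤i }

module _ {k : ℕ} (y : Seq k) where

  PrefixClassIsolated : ℕ → Set
  PrefixClassIsolated m = ∀ t → ¬ (factorAt y 0 m ∼ factorAt y (suc t) m)

  noRightExtension⇒prefixClassIsolated : ∀ {m} → ¬ HasRightExtension y (reverse (factorAt y 0 m)) →
                                         PrefixClassIsolated m
  noRightExtension⇒prefixClassIsolated {m} ¬ext t (inj₁ eq) =
    ¬ext (subst (HasRightExtension y ∘ reverse) eq (reversedFactor-hasRightExtension y t m))
  noRightExtension⇒prefixClassIsolated {m} ¬ext t (inj₂ eq) =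
    ¬ext (subst (HasRightExtension y) eq (factor-hasRightExtension y (suc t) m))

  prefixClassIsolated-suc : ∀ {m} → PrefixClassIsolated m → PrefixClassIsolated (suc m)
  prefixClassIsolated-suc {m} isolated t (inj₁ eq) = isolated t (inj₁ (begin
    factorAt y (suc t) m               ≡⟨ factorAt-init y (suc t) m ⟨
    init (factorAt y (suc t) (suc m))  ≡⟨ cong init eq ⟩
    init (factorAt y 0 (suc m))        ≡⟨ factorAt-init y 0 m ⟩
    factorAt y 0 m                     ∎))
    where open ≡-Reasoning
  prefixClassIsolated-suc {m} isolated t (inj₂ eq) = isolated (suc t) (inj₂ (begin
    factorAt y (suc (suc t)) m                ≡⟨ factorAt-tail y (suc t) m ⟨
    tail (factorAt y (suc t) (suc m))         ≡⟨ cong tail eq ⟩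
    tail (reverse (factorAt y 0 (suc m)))     ≡⟨ tail-reverse _ ⟩
    reverse (init (factorAt y 0 (suc m)))     ≡⟨ cong reverse (factorAt-init y 0 m) ⟩
    reverse (factorAt y 0 m)                  ∎))
    where open ≡-Reasoning

  shift-rcomplexity : ∀ {m c} → PrefixClassIsolated m → RComplexity y m (suc c) → RComplexity (shift y) m c
  shift-rcomplexity {m} {c} isolated (L , factor , distinct , cover) = L′ , factor′ , distinct′ , cover′
    where
    p : Word k m
    p = factorAt y 0 m

    i₀ : Fin (suc c)
    i₀ = proj₁ (cover p (0 , refl))

    p∼i₀ : p ∼ lookup L i₀
    p∼i₀ = proj₂ (cover p (0 , refl))

    L′ : Vec (Word k m) c
    L′ = tabulate (lookup L ∘ punchIn i₀)

    L′-lookup : ∀ j → lookup L′ j ≡ lookup L (punchIn i₀ j)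
    L′-lookup = lookup∘tabulate (lookup L ∘ punchIn i₀)

    factor′ : ∀ j → IsFactor (shift y) (lookup L′ j)
    factor′ j with factor (punchIn i₀ j)
    ... | zero  , eq = contradiction (∼-trans (∼-sym p∼i₀) (inj₁ (sym eq)))
                         (distinct i₀ (punchIn i₀ j) (punchInᵢ≢i i₀ j ∘ sym))
    ... | suc t , eq = t , trans eq (sym (L′-lookup j))

    distinct′ : ∀ j j′ → j ≢ j′ → ¬ (lookup L′ j ∼ lookup L′ j′)
    distinct′ j j′ j≢j′ =
      distinct _ _ (j≢j′ ∘ punchIn-injective i₀ j j′) ∘ subst₂ _∼_ (L′-lookup j) (L′-lookup j′)

    cover′ : ∀ w → IsFactor (shift y) w → ∃ λ j → w ∼ lookup L′ j
    cover′ w (t , eq) with cover w (suc t , eq)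
    ... | a , w∼a with i₀ Fin.≟ a
    ...   | yes refl = contradiction (subst (p ∼_) (sym eq) (∼-trans p∼i₀ (∼-sym w∼a))) (isolated t)
    ...   | no i₀≢a  = punchOut i₀≢a ,
      subst (w ∼_) (trans (cong (lookup L) (sym (punchIn-punchOut i₀≢a))) (sym (L′-lookup _))) w∼a

stableRComplexity⇒eventuallyPeriodic : ∀ c {k m} (y : Seq k) → NoPalindromesOfLength y m →
  RComplexity y m c → RComplexity y (suc m) c → EventuallyPeriodic y
stableRComplexity⇒eventuallyPeriodic zero {m = m} y _ (_ , _ , _ , cover) _
  with () ← cover (factorAt y 0 m) (0 , refl)
stableRComplexity⇒eventuallyPeriodic (suc c) {m = m} y noPal R R′
  with any? (λ j → init (oriented y R′ j) ≟ʷ reverse (factorAt y 0 m))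
... | yes extends-p̃ =
  rightDeterministic⇒eventuallyPeriodic y m
    (init-injective⇒rightDeterministic y R′ (reversedPrefixExtends⇒init-injective y noPal R R′ extends-p̃))
    (finitelyManyFactors⇒hasRepeatedFactor y m (λ t → oriented-complete y R (inj₁ (t , refl))))
... | no ¬extends-p̃ = eventuallyPeriodic-shift⁻
  (stableRComplexity⇒eventuallyPeriodic c (shift y) (noPal ∘ suc)
    (shift-rcomplexity y isolated R) (shift-rcomplexity y (prefixClassIsolated-suc y isolated) R′))
  where
  isolated : PrefixClassIsolated y m
  isolated = noRightExtension⇒prefixClassIsolated y (¬extends-p̃ ∘ rightExtension-index y R′)

theorem3p19 : (k n₀ : ℕ) (x : Seq k) → NoPalindromesFrom x n₀ →
    ((n : ℕ) → n ≥ n₀ → (a b : ℕ) → RComplexity x n a → RComplexity x (n + 1) b → a ≤ b)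
    × ((n : ℕ) → n ≥ n₀ → (a : ℕ) → RComplexity x n a → RComplexity x (n + 2) a → EventuallyPeriodic x)
theorem3p19 _ n₀ x noPal = monotone , stable⇒periodic
  where
  monotone : (n : ℕ) → n ≥ n₀ → (a b : ℕ) → RComplexity x n a → RComplexity x (n + 1) b → a ≤ b
  monotone n n≥n₀ a b R R′ =
    rcomplexity-monotone x (noPal n n≥n₀) R (subst (λ l → RComplexity x l b) (+-comm n 1) R′)

  stable⇒periodic : (n : ℕ) → n ≥ n₀ → (a : ℕ) →
                    RComplexity x n a → RComplexity x (n + 2) a → EventuallyPeriodic x
  stable⇒periodic n n≥n₀ a R R″ =
    stableRComplexity⇒eventuallyPeriodic a x (noPal n n≥n₀) R
      (subst (RComplexity x (suc n)) (≤-antisym b≤a a≤b) R′)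
    where
    R₂ : RComplexity x (suc (suc n)) a
    R₂ = subst (λ l → RComplexity x l a) (+-comm n 2) R″
    b : ℕ
    b = proj₁ (rcomplexity-shorter x R₂)
    R′ : RComplexity x (suc n) b
    R′ = proj₂ (rcomplexity-shorter x R₂)
    a≤b : a ≤ b
    a≤b = rcomplexity-monotone x (noPal n n≥n₀) R R′
    b≤a : b ≤ a
    b≤a = rcomplexity-monotone x (noPal (suc n) (m≤n⇒m≤1+n n≥n₀)) R′ R₂
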